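{- Let $b,c_1,c_2$ be positive integers and let $\alpha/\beta$ be the right lobster $\mathcal{L}^{c_1,c_2}_b$, with $c_1$, $b$, $c_2$ cells in the top, middle and bottom rows respectively. Then the rank of the poset $\mathrm{SET}(\alpha/\beta)$ (the length of its longest chain) is $$\mathrm{rank}(\mathrm{SET}(\alpha/\beta))=\begin{cases} c_2(b+c_1)-\binom{c_1+1}{2} & \text{if } c_1\le c_2,\\ bc_1+\binom{c_2}{2} & \text{if } c_1>c_2.\end{cases}$$
   Context: The right lobster $\mathcal{L}^{c_1,c_2}_b$ is the skew diagram $\alpha/\beta$ with $\alpha=(b+1+c_2,b+1,b+1+c_1)$, $\beta=(b+1,1,b+1)$ (cells of the diagram of $\alpha$ not in that of $\beta$; diagrams have $\alpha_i$ left-justified cells in row $i$, rows numbered from the bottom): a top row of $c_1$ cells and a bottom row of $c_2$ cells, both starting at column $b+2$, and a middle row of $b$ cells in columns $2,\ldots,b+1$. Let $n=b+c_1+c_2$. A standard extended tableau is a bijective filling of the cells with $1,\ldots,n$ strictly increasing left to right along rows and bottom to top along columns; $\mathrm{SET}(\alpha/\beta)$ denotes the set of these. For $1\le i\le n-1$, $\pi_i(T)=T$ if $i+1$ is in a strictly higher row than $i$, $\pi_i(T)=s_i(T)$ (swap $i$ and $i+1$) if $i+1$ is in a strictly lower row than $i$, and $\pi_i(T)=0$ if they are in the same row. Poset on $\mathrm{SET}(\alpha/\beta)$: $S\le T$ iff $T$ is obtained from $S$ by a finite sequence of operators $\pi_i$ with all intermediate results nonzero. The length of a chain $x_0<x_1<\cdots<x_r$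 is $r$. -}

module Defs where

open import Data.Nat using (ℕ; zero; suc; _+_; _*_; _∸_; _≤_; _<_; _≤ᵇ_)
open import Data.Bool using (if_then_else_)
open import Data.Nat.Properties using (<-cmp)
open import Data.Nat.Combinatorics using (_C_)
open import Data.Fin using (Fin; toℕ)
open import Data.Vec using (Vec; lookup; _[_]≔_)
open import Data.List using (List; []; _∷_; length)
open import Data.List.Relation.Unary.All using (All)
open import Data.List.Relation.Unary.Linked using (Linked)
open import Data.Product using (Σ; ∃; _×_; _,_; proj₁; proj₂)
open import Data.Maybe using (Maybe; just; nothing)
open import Relation.Binary.PropositionalEquality using (_≡_; _≢_)
open import Relation.Binary.Construct.Closure.ReflexiveTransitive using (Star)
open import Relation.Binary.Definitions using (tri<; tri≈; tri>)

-- A cell is (row , column); rows numbered from the bottom starting at 1,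
-- columns numbered from the left starting at 1.
Cell : Set
Cell = ℕ × ℕ

row : Cell → ℕ
row = proj₁

col : Cell → ℕ
col = proj₂

-- 1-indexed entry of a composition, 0 outside (row 0 or beyond length).
entry : List ℕ → ℕ → ℕ
entry xs zero = 0
entry [] (suc r) = 0
entry (x ∷ xs) (suc zero) = x
entry (x ∷ xs) (suc (suc r)) = entry xs (suc r)

InShape : List ℕ → List ℕ → Cell → Set
InShape α β (r , j) = entry β r < j × j ≤ entry α r

-- A filling with 1..n is encoded by the vector of positions:
-- lookup T k is the cell containing the number (toℕ k + 1).
Filling : ℕ → Set
Filling n = Vec Cell n

record IsSET (α β : List ℕ) (n : ℕ) (T : Filling n) : Set where
  field
    inShape   : ∀ k → InShape α β (lookup T k)
    onto      : ∀ c → InShape α β c → ∃ λ k → lookup T k ≡ c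
    injective : ∀ k l → lookup T k ≡ lookup T l → k ≡ l
    rowInc    : ∀ k l → row (lookup T k) ≡ row (lookup T l) →
                col (lookup T k) < col (lookup T l) → toℕ k < toℕ l
    colInc    : ∀ k l → col (lookup T k) ≡ col (lookup T l) →
                row (lookup T k) < row (lookup T l) → toℕ k < toℕ l

-- The operator π_i with i = toℕ k + 1 and i + 1 = toℕ l + 1 (so toℕ l ≡ suc (toℕ k)).
-- nothing represents the value 0.
π : ∀ {n} → Filling n → (k l : Fin n) → Maybe (Filling n)
π T k l with <-cmp (row (lookup T k)) (row (lookup T l))
... | tri< _ _ _ = just T
... | tri≈ _ _ _ = nothing
... | tri> _ _ _ = just ((T [ k ]≔ lookup T l) [ l ]≔ lookup T k)

Step : List ℕ → List ℕ → (n : ℕ) → Filling n → Filling n → Set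
Step α β n S T = IsSET α β n S × IsSET α β n T ×
  Σ (Fin n) λ k → Σ (Fin n) λ l → toℕ l ≡ suc (toℕ k) × π S k l ≡ just T

LeSET : (α β : List ℕ) (n : ℕ) → Filling n → Filling n → Set
LeSET α β n = Star (Step α β n)

Lt : (α β : List ℕ) (n : ℕ) → Filling n → Filling n → Set
Lt α β n S T = LeSET α β n S T × S ≢ T

record Chain (α β : List ℕ) (n : ℕ) (r : ℕ) : Set where
  field
    elems   : List (Filling n)
    len     : length elems ≡ suc r
    allSET  : All (IsSET α β n) elems
    strict  : Linked (Lt α β n) elems

IsRank : (α β : List ℕ) (n : ℕ) → ℕ → Set
IsRank α β n R = Chain α β n R × (∀ r → Chain α β n r → r ≤ R)

lobsterα : ℕ → ℕ → ℕ → List ℕ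
lobsterα b c₁ c₂ = (b + 1 + c₂) ∷ (b + 1) ∷ (b + 1 + c₁) ∷ []

lobsterβ : ℕ → ℕ → ℕ → List ℕ
lobsterβ b c₁ c₂ = (b + 1) ∷ 1 ∷ (b + 1) ∷ []

lobsterRank : ℕ → ℕ → ℕ → ℕ
lobsterRank b c₁ c₂ =
  if c₁ ≤ᵇ c₂ then c₂ * (b + c₁) ∸ ((c₁ + 1) C 2) else b * c₁ + (c₂ C 2)

-- A nontrivial step π_i swaps i and i + 1 when i + 1 sits in a lower row. Such a swap
-- removes exactly one inversion of the word of rows read off 1, 2, …, n, and a tableau
-- whose row word has an inversion has such a descent, so from any tableau T there is a
-- chain of length inv(T). Conversely, each proper step strictly decreases the number of
-- pairs of cells in which the higher cell holds the smaller entry, so no chain is longer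
-- than this count. For the lobster it is at most b·max(c₁, c₂) + Σ_{i<c₁} (c₂ − i − 1):
-- a middle cell is inverted with at most one of the top and bottom cells of any column,
-- and the i-th top cell only with bottom cells to its right. Both bounds are attained by
-- the tableaux with row words  middle^b (bottom top)^c₁ bottom^(c₂−c₁)  when c₁ ≤ c₂, and
-- (bottom top)^c₂ top^(c₁−c₂) middle^b  otherwise.

module Submission where

open import Defs
open import Data.Nat
  using (ℕ; zero; suc; _+_; _*_; _∸_; _⊔_; _≤_; _<_; _≤ᵇ_; z≤n; s≤s; s≤s⁻¹; z<s; _<?_; _≟_)
open import Data.Nat.Properties
open import Data.Nat.Combinatorics using (_C_; nC1≡n; nCk+nC[k+1]≡[n+1]C[k+1])
open import Data.Nat.Tactic.RingSolver using (solve-∀)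
open import Algebra.Properties.CommutativeSemigroup +-commutativeSemigroup
  using () renaming (x∙yz≈y∙xz to +-exchange; interchange to +-interchange)
open import Data.Fin as Fin using (Fin; zero; suc; toℕ)
open import Data.Fin.Properties using (toℕ-injective) renaming (suc-injective to Fin-suc-injective)
open import Data.List using (List; []; _∷_; length)
open import Data.Vec using (Vec; []; _∷_; _++_; replicate; lookup; _[_]≔_)
open import Data.Vec.Properties using (lookup∘update; lookup∘update′)
open import Data.List.Relation.Unary.All using (All; []; _∷_)
open import Data.List.Relation.Unary.Linked using (Linked; [-]; _∷_)
open import Relation.Binary.Construct.Closure.ReflexiveTransitive using (ε; _◅_)
open import Data.Maybe using (just)
open import Data.Maybe.Properties using (just-injective)
open import Data.Product using (Σ; ∃; _×_; _,_)
open import Data.Product.Properties using (≡-dec)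
open import Data.Sum using (_⊎_; inj₁; inj₂)
open import Data.Empty using (⊥-elim)
open import Data.Unit using (⊤; tt)
open import Data.Bool using (true; false; T)
open import Relation.Nullary using (¬_; Dec; yes; no)
open import Relation.Nullary.Decidable using (map′)
open import Relation.Binary.PropositionalEquality
open import Relation.Binary.Definitions using (tri<; tri≈; tri>)

-- Adjacent transpositions

Adjacent : ∀ {n} → Fin n → Fin n → Set
Adjacent k l = toℕ l ≡ suc (toℕ k)

Adjacent⇒≢ : ∀ {n} {k l : Fin n} → Adjacent k l → k ≢ l
Adjacent⇒≢ adj refl = 1+n≢n (sym adj)

swap : ∀ {a} {A : Set a} {n} → Vec A n → Fin n → Fin n → Vec A n
swap T k l = (T [ k ]≔ lookup T l) [ l ]≔ lookup T k

transposition : ∀ {n} → Fin n → Fin n → Fin n → Fin n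
transposition k l m with m Fin.≟ k | m Fin.≟ l
... | yes _ | _     = l
... | no _  | yes _ = k
... | no _  | no _  = m

data TranspositionView {n} (k l m : Fin n) : Fin n → Set where
  at-k  : m ≡ k → TranspositionView k l m l
  at-l  : m ≢ k → m ≡ l → TranspositionView k l m k
  fixed : m ≢ k → m ≢ l → TranspositionView k l m m

transposition-view : ∀ {n} (k l m : Fin n) → TranspositionView k l m (transposition k l m)
transposition-view k l m with m Fin.≟ k | m Fin.≟ l
... | yes p | _     = at-k p
... | no p  | yes q = at-l p q
... | no p  | no q  = fixed p q

transposition-involutive : ∀ {n} (k l m : Fin n) → transposition k l (transposition k l m) ≡ m
transposition-involutive k l m with transposition k l m | transposition-view k l m
... | _ | at-k refl with transposition k l l | transposition-view k l l
...   | _ | at-k l≡k   = l≡k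
...   | _ | at-l _ _   = refl
...   | _ | fixed _ l≢l = ⊥-elim (l≢l refl)
transposition-involutive k l m | _ | at-l m≢k refl with transposition k l k | transposition-view k l k
...   | _ | at-k _     = refl
...   | _ | at-l k≢k _ = ⊥-elim (k≢k refl)
...   | _ | fixed k≢k _ = ⊥-elim (k≢k refl)
transposition-involutive k l m | _ | fixed m≢k m≢l with transposition k l m | transposition-view k l m
...   | _ | at-k m≡k   = ⊥-elim (m≢k m≡k)
...   | _ | at-l _ m≡l = ⊥-elim (m≢l m≡l)
...   | _ | fixed _ _  = refl

lookup-swap-left : ∀ {a} {A : Set a} {n} (T : Vec A n) {k l : Fin n} → k ≢ l →
                   lookup (swap T k l) k ≡ lookup T l
lookup-swap-left T {k} {l} k≢l =
  trans (lookup∘update′ k≢l (T [ k ]≔ lookup T l) (lookup T k)) (lookup∘update k T (lookup T l))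

lookup-swap-right : ∀ {a} {A : Set a} {n} (T : Vec A n) (k l : Fin n) → lookup (swap T k l) l ≡ lookup T k
lookup-swap-right T k l = lookup∘update l (T [ k ]≔ lookup T l) (lookup T k)

lookup-swap : ∀ {a} {A : Set a} {n} (T : Vec A n) {k l : Fin n} → k ≢ l →
              ∀ m → lookup (swap T k l) m ≡ lookup T (transposition k l m)
lookup-swap T {k} {l} k≢l m with transposition k l m | transposition-view k l m
... | _ | at-k refl     = lookup-swap-left T k≢l
... | _ | at-l _ refl   = lookup-swap-right T k l
... | _ | fixed m≢k m≢l =
  trans (lookup∘update′ m≢l (T [ k ]≔ lookup T l) (lookup T k)) (lookup∘update′ m≢k T (lookup T l))

transposition-reflects-< : ∀ {n} {k l : Fin n} → Adjacent k l → ∀ p q →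
  toℕ (transposition k l p) < toℕ (transposition k l q) → toℕ p < toℕ q ⊎ (p ≡ l × q ≡ k)
transposition-reflects-< {k = k} {l} adj p q lt
  with transposition k l p | transposition-view k l p | transposition k l q | transposition-view k l q
... | _ | at-k refl   | _ | at-k refl   = ⊥-elim (<-irrefl refl lt)
... | _ | at-k refl   | _ | at-l _ refl = inj₁ (≤-reflexive (sym adj))
... | _ | at-k refl   | _ | fixed _ _   = inj₁ (<-trans (≤-reflexive (sym adj)) lt)
... | _ | at-l _ refl | _ | at-k refl   = inj₂ (refl , refl)
... | _ | at-l _ refl | _ | at-l _ _    = ⊥-elim (<-irrefl refl lt)
... | _ | at-l _ refl | _ | fixed _ q≢l =
  inj₁ (≤∧≢⇒< (subst (_≤ toℕ q) (sym adj) lt) λ e → q≢l (toℕ-injective (sym e)))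
... | _ | fixed p≢k _ | _ | at-k refl   =
  inj₁ (≤∧≢⇒< (s≤s⁻¹ (subst (toℕ p <_) adj lt)) λ e → p≢k (toℕ-injective e))
... | _ | fixed _ _   | _ | at-l _ refl = inj₁ (<-trans lt (≤-reflexive (sym adj)))
... | _ | fixed _ _   | _ | fixed _ _   = inj₁ lt

module _ {α β : List ℕ} {n : ℕ} {T : Filling n} {k l : Fin n}
         (adj : Adjacent k l) (descent : row (lookup T l) < row (lookup T k)) (T-SET : IsSET α β n T) where
  open IsSET T-SET

  private
    τ : Fin n → Fin n
    τ = transposition k l

    swapped : ∀ m → lookup (swap T k l) m ≡ lookup T (τ m)
    swapped = lookup-swap T (Adjacent⇒≢ adj)

    swapped-on : ∀ (f : Cell → ℕ) m → f (lookup (swap T k l) m) ≡ f (lookup T (τ m))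
    swapped-on f m = cong f (swapped m)

    swap-left : lookup (swap T k l) k ≡ lookup T l
    swap-left = lookup-swap-left T (Adjacent⇒≢ adj)

    swap-right : lookup (swap T k l) l ≡ lookup T k
    swap-right = lookup-swap-right T k l

  swap-SET : IsSET α β n (swap T k l)
  IsSET.inShape swap-SET m = subst (InShape α β) (sym (swapped m)) (inShape (τ m))
  IsSET.onto swap-SET c c∈ with onto c c∈
  ... | m , refl = τ m , trans (swapped (τ m)) (cong (lookup T) (transposition-involutive k l m))
  IsSET.injective swap-SET p q eq = begin
    p           ≡⟨ transposition-involutive k l p ⟨
    τ (τ p)     ≡⟨ cong τ (injective (τ p) (τ q) (trans (sym (swapped p)) (trans eq (swapped q)))) ⟩
    τ (τ q)     ≡⟨ transposition-involutive k l q ⟩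
    q           ∎
    where open ≡-Reasoning
  IsSET.rowInc swap-SET p q same-row col<
    with transposition-reflects-< adj p q
           (rowInc (τ p) (τ q) (trans (sym (swapped-on row p)) (trans same-row (swapped-on row q)))
                   (subst₂ _<_ (swapped-on col p) (swapped-on col q) col<))
  ... | inj₁ p<q = p<q
  ... | inj₂ (refl , refl) =
    ⊥-elim (<-irrefl (trans (cong row (sym swap-left)) (trans (sym same-row) (cong row swap-right))) descent)
  IsSET.colInc swap-SET p q same-col row<
    with transposition-reflects-< adj p q
           (colInc (τ p) (τ q) (trans (sym (swapped-on col p)) (trans same-col (swapped-on col q)))
                   (subst₂ _<_ (swapped-on row p) (swapped-on row q) row<))
  ... | inj₁ p<q = p<q
  ... | inj₂ (refl , refl) = ⊥-elim (<-asym descent (subst₂ _<_ (cong row swap-right) (cong row swap-left) row<))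

π-descent : ∀ {n} (T : Filling n) {k l : Fin n} → row (lookup T l) < row (lookup T k) →
            π T k l ≡ just (swap T k l)
π-descent T {k} {l} descent with <-cmp (row (lookup T k)) (row (lookup T l))
... | tri< lt _ _ = ⊥-elim (<-asym lt descent)
... | tri≈ _ eq _ = ⊥-elim (<-irrefl (sym eq) descent)
... | tri> _ _ _  = refl

π-fixes-or-swaps-descent : ∀ {n} (S T : Filling n) k l → π S k l ≡ just T →
  T ≡ S ⊎ (row (lookup S l) < row (lookup S k) × T ≡ swap S k l)
π-fixes-or-swaps-descent S T k l eq with <-cmp (row (lookup S k)) (row (lookup S l))
... | tri< _ _ _ = inj₁ (sym (just-injective eq))
... | tri> _ _ gt = inj₂ (gt , sym (just-injective eq))

-- Inversions

⟦_<_⟧ : ℕ → ℕ → ℕ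
⟦ p < q ⟧ with p <? q
... | yes _ = 1
... | no _  = 0

⟦⟧-true : ∀ {p q} → p < q → ⟦ p < q ⟧ ≡ 1
⟦⟧-true {p} {q} p<q with p <? q
... | yes _   = refl
... | no p≮q = ⊥-elim (p≮q p<q)

⟦⟧-false : ∀ {p q} → ¬ p < q → ⟦ p < q ⟧ ≡ 0
⟦⟧-false {p} {q} p≮q with p <? q
... | yes p<q = ⊥-elim (p≮q p<q)
... | no _    = refl

⟦⟧≤1 : ∀ p q → ⟦ p < q ⟧ ≤ 1
⟦⟧≤1 p q with p <? q
... | yes _ = ≤-refl
... | no _  = z≤n

⟦⟧-mono : ∀ {p q r s} → (p < q → r < s) → ⟦ p < q ⟧ ≤ ⟦ r < s ⟧
⟦⟧-mono {p} {q} f with p <? q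
... | no _    = z≤n
... | yes p<q = ≤-reflexive (sym (⟦⟧-true (f p<q)))

⟦⟧-exclusive : ∀ {p q r s} → (p < q → ¬ r < s) → ⟦ p < q ⟧ + ⟦ r < s ⟧ ≤ 1
⟦⟧-exclusive {p} {q} {r} {s} f with p <? q
... | no _    = ⟦⟧≤1 r s
... | yes p<q = ≤-reflexive (cong suc (⟦⟧-false (f p<q)))

module Inversions {a} {A : Set a} (key : A → ℕ) where

  below : ∀ {m} → ℕ → Vec A m → ℕ
  below r []       = 0
  below r (x ∷ xs) = ⟦ key x < r ⟧ + below r xs

  inversions : ∀ {m} → Vec A m → ℕ
  inversions []       = 0
  inversions (x ∷ xs) = below (key x) xs + inversions xs

  Sorted : ∀ {m} → Vec A m → Set
  Sorted []           = ⊤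
  Sorted (x ∷ [])     = ⊤
  Sorted (x ∷ y ∷ xs) = key x ≤ key y × Sorted (y ∷ xs)

  record Descent {m} (xs : Vec A m) : Set where
    field
      {k l}    : Fin m
      adjacent : Adjacent k l
      descends : key (lookup xs l) < key (lookup xs k)

  descent-or-sorted : ∀ {m} (xs : Vec A m) → Descent xs ⊎ Sorted xs
  descent-or-sorted []      = inj₂ tt
  descent-or-sorted (x ∷ []) = inj₂ tt
  descent-or-sorted (x ∷ y ∷ xs) with descent-or-sorted (y ∷ xs)
  ... | inj₁ d = inj₁ (record { adjacent = cong suc (Descent.adjacent d) ; descends = Descent.descends d })
  ... | inj₂ sorted with key y <? key x
  ...   | yes y<x = inj₁ (record { k = zero ; l = suc zero ; adjacent = refl ; descends = y<x })
  ...   | no y≮x  = inj₂ (≮⇒≥ y≮x , sorted)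

  below-sorted : ∀ {m} r (x : A) (xs : Vec A m) → Sorted (x ∷ xs) → r ≤ key x → below r (x ∷ xs) ≡ 0
  below-sorted r x []       _               r≤x rewrite ⟦⟧-false (≤⇒≯ r≤x) = refl
  below-sorted r x (y ∷ xs) (x≤y , sorted) r≤x rewrite ⟦⟧-false (≤⇒≯ r≤x) =
    below-sorted r y xs sorted (≤-trans r≤x x≤y)

  sorted⇒inversions≡0 : ∀ {m} (xs : Vec A m) → Sorted xs → inversions xs ≡ 0
  sorted⇒inversions≡0 []           _               = refl
  sorted⇒inversions≡0 (x ∷ [])     _               = refl
  sorted⇒inversions≡0 (x ∷ y ∷ xs) (x≤y , sorted) =
    cong₂ _+_ (below-sorted (key x) y xs sorted x≤y) (sorted⇒inversions≡0 (y ∷ xs) sorted)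

  below-++ : ∀ {m m′} r (xs : Vec A m) (ys : Vec A m′) → below r (xs ++ ys) ≡ below r xs + below r ys
  below-++ r []       ys = refl
  below-++ r (x ∷ xs) ys = trans (cong (⟦ key x < r ⟧ +_) (below-++ r xs ys)) (sym (+-assoc ⟦ key x < r ⟧ _ _))

  below-replicate : ∀ r m x → below r (replicate m x) ≡ m * ⟦ key x < r ⟧
  below-replicate r zero    x = refl
  below-replicate r (suc m) x = cong (⟦ key x < r ⟧ +_) (below-replicate r m x)

  below-replicate-self : ∀ m x → below (key x) (replicate m x) ≡ 0
  below-replicate-self m x =
    trans (below-replicate (key x) m x) (trans (cong (m *_) (⟦⟧-false (<-irrefl refl))) (*-zeroʳ m))

  inversions-replicate-++ : ∀ {m′} m x (ys : Vec A m′) →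
                            inversions (replicate m x ++ ys) ≡ m * below (key x) ys + inversions ys
  inversions-replicate-++ zero    x ys = refl
  inversions-replicate-++ (suc m) x ys = begin
    below (key x) (replicate m x ++ ys) + inversions (replicate m x ++ ys)
      ≡⟨ cong₂ _+_ (below-++ (key x) (replicate m x) ys) (inversions-replicate-++ m x ys) ⟩
    below (key x) (replicate m x) + B + (m * B + R) ≡⟨ cong (λ t → t + B + (m * B + R)) (below-replicate-self m x) ⟩
    B + (m * B + R)                                 ≡⟨ +-assoc B (m * B) R ⟨
    suc m * B + R                                   ∎
    where
    open ≡-Reasoning
    B = below (key x) ys
    R = inversions ys

  inversions-replicate : ∀ m x → inversions (replicate m x) ≡ 0
  inversions-replicate zero    x = refl
  inversions-replicate (suc m) x = cong₂ _+_ (below-replicate-self m x) (inversions-replicate m x)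

  below-swap : ∀ {m} r (xs : Vec A m) {k l} → Adjacent k l → below r (swap xs k l) ≡ below r xs
  below-swap r (x ∷ y ∷ xs) {zero}  {suc zero} refl = +-exchange ⟦ key y < r ⟧ ⟦ key x < r ⟧ (below r xs)
  below-swap r (x ∷ xs)     {suc k} {suc l}    adj  = cong (⟦ key x < r ⟧ +_) (below-swap r xs (suc-injective adj))

  inversions-swap : ∀ {m} (xs : Vec A m) {k l} → Adjacent k l → key (lookup xs l) < key (lookup xs k) →
                    suc (inversions (swap xs k l)) ≡ inversions xs
  inversions-swap (x ∷ y ∷ xs) {zero} {suc zero} refl y<x
    rewrite ⟦⟧-false (<-asym y<x) | ⟦⟧-true y<x =
    cong suc (+-exchange (below (key y) xs) (below (key x) xs) (inversions xs))
  inversions-swap (x ∷ xs) {suc k} {suc l} adj descends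
    rewrite below-swap (key x) xs (suc-injective adj) =
    trans (sym (+-suc _ _)) (cong (below (key x) xs +_) (inversions-swap xs (suc-injective adj) descends))

-- Chains in SET(α/β)

module _ {α β : List ℕ} {n : ℕ} where
  open Inversions row

  ChainFrom : Filling n → ℕ → Set
  ChainFrom T r = Σ (List (Filling n)) λ xs →
    length xs ≡ r × All (IsSET α β n) (T ∷ xs) × Linked (Lt α β n) (T ∷ xs)

  chain-of-descents : ∀ m (T : Filling n) → IsSET α β n T → inversions T ≡ m → ChainFrom T m
  chain-of-descents zero    T T-SET _ = [] , refl , T-SET ∷ [] , [-]
  chain-of-descents (suc m) T T-SET inv≡ with descent-or-sorted T
  ... | inj₂ sorted = ⊥-elim (1+n≢0 (trans (sym inv≡) (sorted⇒inversions≡0 T sorted)))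
  ... | inj₁ record { k = k ; l = l ; adjacent = adj ; descends = desc }
    with chain-of-descents m (swap T k l) (swap-SET adj desc T-SET)
                           (suc-injective (trans (inversions-swap T adj desc) inv≡))
  ...   | xs , len , all , linked = swap T k l ∷ xs , cong suc len , T-SET ∷ all , (step ◅ ε , T≢swap) ∷ linked
    where
    step : Step α β n T (swap T k l)
    step = T-SET , swap-SET adj desc T-SET , k , l , adj , π-descent T desc
    T≢swap : T ≢ swap T k l
    T≢swap eq = 1+n≢n (trans (inversions-swap T adj desc) (cong inversions eq))

  chain-from-SET : ∀ (T : Filling n) → IsSET α β n T → Chain α β n (inversions T)
  chain-from-SET T T-SET with chain-of-descents (inversions T) T T-SET refl
  ... | xs , len , all , linked = record { elems = T ∷ xs ; len = cong suc len ; allSET = all ; strict = linked }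

  module _ (Φ : Filling n → ℕ) (Φ-step : ∀ {S T} → Step α β n S T → T ≡ S ⊎ Φ T < Φ S) where

    Φ-antitone : ∀ {S T} → LeSET α β n S T → Φ T ≤ Φ S
    Φ-antitone ε = ≤-refl
    Φ-antitone (s ◅ ss) with Φ-step s
    ... | inj₁ refl = Φ-antitone ss
    ... | inj₂ Φ<   = ≤-trans (Φ-antitone ss) (<⇒≤ Φ<)

    Φ-strictly-antitone : ∀ {S T} → LeSET α β n S T → S ≢ T → Φ T < Φ S
    Φ-strictly-antitone ε        S≢S = ⊥-elim (S≢S refl)
    Φ-strictly-antitone (s ◅ ss) S≢T with Φ-step s
    ... | inj₁ refl = Φ-strictly-antitone ss S≢T
    ... | inj₂ Φ<   = ≤-<-trans (Φ-antitone ss) Φ<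

    length≤Φ : ∀ x xs → Linked (Lt α β n) (x ∷ xs) → length xs ≤ Φ x
    length≤Φ x []       _              = z≤n
    length≤Φ x (y ∷ xs) ((x≤y , x≢y) ∷ linked) =
      ≤-trans (s≤s (length≤Φ y xs linked)) (Φ-strictly-antitone x≤y x≢y)

    chain-length≤ : ∀ {V} → (∀ T → IsSET α β n T → Φ T ≤ V) → ∀ r → Chain α β n r → r ≤ V
    chain-length≤ Φ≤V r record { elems = x ∷ xs ; len = len ; allSET = x-SET ∷ _ ; strict = linked } =
      ≤-trans (≤-reflexive (sym (suc-injective len))) (≤-trans (length≤Φ x xs linked) (Φ≤V x x-SET))

-- indexOf T c + 1 is the entry of cell c in T.
indexOf : ∀ {n} → Filling n → Cell → ℕ
indexOf []       c = 0
indexOf (x ∷ xs) c with ≡-dec _≟_ _≟_ x c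
... | yes _ = 0
... | no _  = suc (indexOf xs c)

indexOf-lookup : ∀ {n} (T : Filling n) → (∀ k l → lookup T k ≡ lookup T l → k ≡ l) →
                 ∀ i → indexOf T (lookup T i) ≡ toℕ i
indexOf-lookup (x ∷ xs) inj i with ≡-dec _≟_ _≟_ x (lookup (x ∷ xs) i)
indexOf-lookup (x ∷ xs) inj zero    | yes _   = refl
indexOf-lookup (x ∷ xs) inj (suc i) | yes x≡ with inj zero (suc i) x≡
... | ()
indexOf-lookup (x ∷ xs) inj zero    | no x≢x  = ⊥-elim (x≢x refl)
indexOf-lookup (x ∷ xs) inj (suc i) | no _    =
  cong suc (indexOf-lookup xs (λ k l eq → Fin-suc-injective (inj (suc k) (suc l) eq)) i)

module _ {α β : List ℕ} {n : ℕ} {T : Filling n} (T-SET : IsSET α β n T) where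
  open IsSET T-SET

  indexOf-SET : ∀ i → indexOf T (lookup T i) ≡ toℕ i
  indexOf-SET = indexOf-lookup T injective

  indexOf-row-increasing : ∀ {c d} → InShape α β c → InShape α β d →
                           row c ≡ row d → col c < col d → indexOf T c < indexOf T d
  indexOf-row-increasing {c} {d} c∈ d∈ same-row col< with onto c c∈ | onto d d∈
  ... | i , refl | j , refl = subst₂ _<_ (sym (indexOf-SET i)) (sym (indexOf-SET j)) (rowInc i j same-row col<)

  indexOf-col-increasing : ∀ {c d} → InShape α β c → InShape α β d →
                           col c ≡ col d → row c < row d → indexOf T c < indexOf T d
  indexOf-col-increasing {c} {d} c∈ d∈ same-col row< with onto c c∈ | onto d d∈
  ... | i , refl | j , refl = subst₂ _<_ (sym (indexOf-SET i)) (sym (indexOf-SET j)) (colInc i j same-col row<)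

module _ {α β : List ℕ} {n : ℕ} {S : Filling n} {k l : Fin n}
         (adj : Adjacent k l) (descent : row (lookup S l) < row (lookup S k)) (S-SET : IsSET α β n S) where

  private
    S′ : Filling n
    S′ = swap S k l

    indexOf-swap : ∀ m → indexOf S′ (lookup S m) ≡ toℕ (transposition k l m)
    indexOf-swap m = begin
      indexOf S′ (lookup S m)          ≡⟨ cong (λ i → indexOf S′ (lookup S i)) (transposition-involutive k l m) ⟨
      indexOf S′ (lookup S (τ (τ m)))  ≡⟨ cong (indexOf S′) (lookup-swap S (Adjacent⇒≢ adj) (τ m)) ⟨
      indexOf S′ (lookup S′ (τ m))     ≡⟨ indexOf-SET (swap-SET adj descent S-SET) (τ m) ⟩
      toℕ (τ m)                        ∎
      where
      open ≡-Reasoning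
      τ = transposition k l

  swap-creates-no-inversion : ∀ {h d} → InShape α β h → InShape α β d → row d < row h →
    ⟦ indexOf S′ h < indexOf S′ d ⟧ ≤ ⟦ indexOf S h < indexOf S d ⟧
  swap-creates-no-inversion {h} {d} h∈ d∈ d<h with IsSET.onto S-SET h h∈ | IsSET.onto S-SET d d∈
  ... | i , refl | j , refl
    rewrite indexOf-swap i | indexOf-swap j | indexOf-SET S-SET i | indexOf-SET S-SET j = ⟦⟧-mono reflect
    where
    reflect : toℕ (transposition k l i) < toℕ (transposition k l j) → toℕ i < toℕ j
    reflect lt with transposition-reflects-< adj i j lt
    ... | inj₁ i<j           = i<j
    ... | inj₂ (refl , refl) = ⊥-elim (<-asym descent d<h)

  swap-removes-descent-inversion :
    ⟦ indexOf S′ (lookup S k) < indexOf S′ (lookup S l) ⟧ < ⟦ indexOf S (lookup S k) < indexOf S (lookup S l) ⟧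
  swap-removes-descent-inversion = begin-strict
    ⟦ indexOf S′ (lookup S k) < indexOf S′ (lookup S l) ⟧
      ≡⟨ cong₂ ⟦_<_⟧ (at (lookup-swap-right S k l)) (at (lookup-swap-left S (Adjacent⇒≢ adj))) ⟩
    ⟦ toℕ l < toℕ k ⟧                                   ≡⟨ ⟦⟧-false (<-asym k<l) ⟩
    0                                                   <⟨ z<s ⟩
    1                                                   ≡⟨ ⟦⟧-true k<l ⟨
    ⟦ toℕ k < toℕ l ⟧                                   ≡⟨ cong₂ ⟦_<_⟧ (indexOf-SET S-SET k) (indexOf-SET S-SET l) ⟨
    ⟦ indexOf S (lookup S k) < indexOf S (lookup S l) ⟧ ∎
    where
    open ≤-Reasoning
    k<l : toℕ k < toℕ l
    k<l = ≤-reflexive (sym adj)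
    at : ∀ {m c} → lookup S′ m ≡ c → indexOf S′ c ≡ toℕ m
    at {m} refl = indexOf-SET (swap-SET adj descent S-SET) m

-- Finite sums

∑ : ℕ → (ℕ → ℕ) → ℕ
∑ zero    f = 0
∑ (suc m) f = f 0 + ∑ m (λ i → f (suc i))

∑-mono : ∀ m {f g : ℕ → ℕ} → (∀ i → i < m → f i ≤ g i) → ∑ m f ≤ ∑ m g
∑-mono zero    f≤g = z≤n
∑-mono (suc m) f≤g = +-mono-≤ (f≤g 0 z<s) (∑-mono m λ i i<m → f≤g (suc i) (s≤s i<m))

∑-mono-< : ∀ m {f g : ℕ → ℕ} → (∀ i → i < m → f i ≤ g i) →
           ∀ {j} → j < m → f j < g j → ∑ m f < ∑ m g
∑-mono-< (suc m) f≤g {zero}  _         f<g = +-mono-<-≤ f<g (∑-mono m λ i i<m → f≤g (suc i) (s≤s i<m))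
∑-mono-< (suc m) f≤g {suc j} (s≤s j<m) f<g =
  +-mono-≤-< (f≤g 0 z<s) (∑-mono-< m (λ i i<m → f≤g (suc i) (s≤s i<m)) j<m f<g)

∑-distrib-+ : ∀ m (f g : ℕ → ℕ) → ∑ m (λ i → f i + g i) ≡ ∑ m f + ∑ m g
∑-distrib-+ zero    f g = refl
∑-distrib-+ (suc m) f g = trans (cong (f 0 + g 0 +_) (∑-distrib-+ m _ _)) (+-interchange (f 0) (g 0) _ _)

∑-const : ∀ m c → ∑ m (λ _ → c) ≡ m * c
∑-const zero    c = refl
∑-const (suc m) c = cong (c +_) (∑-const m c)

∑-comm : ∀ m p (F : ℕ → ℕ → ℕ) → ∑ m (λ i → ∑ p (F i)) ≡ ∑ p (λ j → ∑ m (λ i → F i j))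
∑-comm zero    p F = sym (trans (∑-const p 0) (*-zeroʳ p))
∑-comm (suc m) p F = begin
  ∑ p (F 0) + ∑ m (λ i → ∑ p (F (suc i)))         ≡⟨ cong (∑ p (F 0) +_) (∑-comm m p (λ i → F (suc i))) ⟩
  ∑ p (F 0) + ∑ p (λ j → ∑ m (λ i → F (suc i) j)) ≡⟨ ∑-distrib-+ p (F 0) _ ⟨
  ∑ p (λ j → F 0 j + ∑ m (λ i → F (suc i) j))     ∎
  where open ≡-Reasoning

∑-indicator≤∸ : ∀ m k (f : ℕ → ℕ) → (∀ i → f i ≤ 1) → (∀ i → i < k → i < m → f i ≡ 0) →
                ∑ m f ≤ m ∸ k
∑-indicator≤∸ zero    k       f f≤1 f≡0 = z≤n
∑-indicator≤∸ (suc m) zero    f f≤1 f≡0 =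
  +-mono-≤ (f≤1 0) (∑-indicator≤∸ m 0 _ (λ i → f≤1 (suc i)) λ _ ())
∑-indicator≤∸ (suc m) (suc k) f f≤1 f≡0 rewrite f≡0 0 z<s z<s =
  ∑-indicator≤∸ m k _ (λ i → f≤1 (suc i)) λ i i<k i<m → f≡0 (suc i) (s≤s i<k) (s≤s i<m)

∑-indicator≤ : ∀ m (f : ℕ → ℕ) → (∀ i → f i ≤ 1) → ∑ m f ≤ m
∑-indicator≤ m f f≤1 = ∑-indicator≤∸ m 0 f f≤1 λ _ ()

∑+∑-exclusive≤⊔ : ∀ m p (f g : ℕ → ℕ) → (∀ i → f i ≤ 1) → (∀ i → g i ≤ 1) →
                   (∀ i → i < m → i < p → f i + g i ≤ 1) → ∑ m f + ∑ p g ≤ m ⊔ p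
∑+∑-exclusive≤⊔ zero    p       f g f≤1 g≤1 _  = ∑-indicator≤ p g g≤1
∑+∑-exclusive≤⊔ (suc m) zero    f g f≤1 g≤1 _  =
  ≤-trans (≤-reflexive (+-identityʳ _)) (∑-indicator≤ (suc m) f f≤1)
∑+∑-exclusive≤⊔ (suc m) (suc p) f g f≤1 g≤1 fg≤1 = begin
  f 0 + ∑ m f′ + (g 0 + ∑ p g′) ≡⟨ +-interchange (f 0) _ (g 0) _ ⟩
  f 0 + g 0 + (∑ m f′ + ∑ p g′) ≤⟨ +-mono-≤ (fg≤1 0 z<s z<s)
                                     (∑+∑-exclusive≤⊔ m p f′ g′ (λ i → f≤1 (suc i)) (λ i → g≤1 (suc i))
                                        λ i i<m i<p → fg≤1 (suc i) (s≤s i<m) (s≤s i<p)) ⟩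
  suc (m ⊔ p)                   ∎
  where
  open ≤-Reasoning
  f′ g′ : ℕ → ℕ
  f′ i = f (suc i)
  g′ i = g (suc i)

staircase : ℕ → ℕ → ℕ
staircase m c = ∑ m λ i → c ∸ suc i

staircase-zero : ∀ m → staircase m 0 ≡ 0
staircase-zero zero    = refl
staircase-zero (suc m) = staircase-zero m

staircase-overhang : ∀ m e → staircase (m + e) m ≡ staircase m m
staircase-overhang zero    e = staircase-zero e
staircase-overhang (suc m) e = cong (m +_) (staircase-overhang m e)

staircase-shift : ∀ m t → staircase m (m + t) ≡ m * t + staircase m m
staircase-shift zero    t = refl
staircase-shift (suc m) t = begin
  m + t + staircase m (m + t)       ≡⟨ cong (m + t +_) (staircase-shift m t) ⟩
  m + t + (m * t + staircase m m)   ≡⟨ rearrange m t (m * t) (staircase m m) ⟩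
  t + m * t + (m + staircase m m)   ∎
  where
  open ≡-Reasoning
  rearrange : ∀ m t p s → m + t + (p + s) ≡ t + p + (m + s)
  rearrange = solve-∀

staircase-diagonal : ∀ m → staircase m m ≡ m C 2
staircase-diagonal zero    = refl
staircase-diagonal (suc m) = begin
  m + staircase m m  ≡⟨ cong₂ _+_ (sym (nC1≡n m)) (staircase-diagonal m) ⟩
  m C 1 + m C 2      ≡⟨ nCk+nC[k+1]≡[n+1]C[k+1] m 1 ⟩
  suc m C 2          ∎
  where open ≡-Reasoning

staircase-double : ∀ m → m + (staircase m m + staircase m m) ≡ m * m
staircase-double zero    = refl
staircase-double (suc m) = begin
  suc m + (m + s + (m + s))   ≡⟨ rearrange m s ⟩
  suc (m + m + (m + (s + s))) ≡⟨ cong (λ t → suc (m + m + t)) (staircase-double m) ⟩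
  suc (m + m + m * m)         ≡⟨ square-suc m ⟩
  suc m * suc m               ∎
  where
  open ≡-Reasoning
  s = staircase m m
  rearrange : ∀ m s → suc m + (m + s + (m + s)) ≡ suc (m + m + (m + (s + s)))
  rearrange = solve-∀
  square-suc : ∀ m → suc (m + m + m * m) ≡ suc m * suc m
  square-suc = solve-∀

-- Row words

data Part : Set where
  bottom middle top : Part

rowOf : Part → ℕ
rowOf bottom = 1
rowOf middle = 2
rowOf top    = 3

rowOf-injective : ∀ {x y} → rowOf x ≡ rowOf y → x ≡ y
rowOf-injective {bottom} {bottom} _ = refl
rowOf-injective {middle} {middle} _ = refl
rowOf-injective {top}    {top}    _ = refl

_≟ₚ_ : (x y : Part) → Dec (x ≡ y)
x ≟ₚ y = map′ rowOf-injective (cong rowOf) (rowOf x ≟ rowOf y)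

Counts : Set
Counts = ℕ × ℕ × ℕ

count : Part → Counts → ℕ
count bottom (p , _ , _) = p
count middle (_ , q , _) = q
count top    (_ , _ , r) = r

next : Part → Counts → Counts
next bottom (p , q , r) = suc p , q , r
next middle (p , q , r) = p , suc q , r
next top    (p , q , r) = p , q , suc r

count-next-self : ∀ x a → count x (next x a) ≡ suc (count x a)
count-next-self bottom _ = refl
count-next-self middle _ = refl
count-next-self top    _ = refl

count-next-other : ∀ {x y} → x ≢ y → ∀ a → count y (next x a) ≡ count y a
count-next-other {bottom} {bottom} x≢y _ = ⊥-elim (x≢y refl)
count-next-other {bottom} {middle} _   _ = refl
count-next-other {bottom} {top}    _   _ = refl
count-next-other {middle} {bottom} _   _ = refl
count-next-other {middle} {middle} x≢y _ = ⊥-elim (x≢y refl)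
count-next-other {middle} {top}    _   _ = refl
count-next-other {top}    {bottom} _   _ = refl
count-next-other {top}    {middle} _   _ = refl
count-next-other {top}    {top}    x≢y _ = ⊥-elim (x≢y refl)

count-next-≤ : ∀ x y a → count y a ≤ count y (next x a)
count-next-≤ x y a with x ≟ₚ y
... | yes refl = ≤-trans (n≤1+n (count x a)) (≤-reflexive (sym (count-next-self x a)))
... | no x≢y   = ≤-reflexive (sym (count-next-other x≢y a))

tally : ∀ {m} → Vec Part m → Counts → Counts
tally []      a = a
tally (x ∷ w) a = tally w (next x a)

tally-++ : ∀ {m m′} (u : Vec Part m) (v : Vec Part m′) a → tally (u ++ v) a ≡ tally v (tally u a)
tally-++ []      v a = refl
tally-++ (x ∷ u) v a = tally-++ u v (next x a)

count-tally-≤ : ∀ {m} y (w : Vec Part m) a → count y a ≤ count y (tally w a)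
count-tally-≤ y []      a = ≤-refl
count-tally-≤ y (x ∷ w) a = ≤-trans (count-next-≤ x y a) (count-tally-≤ y w (next x a))

pairs : ∀ m → Vec Part (m * 2)
pairs zero    = []
pairs (suc m) = bottom ∷ top ∷ pairs m

tally-replicate-bottom : ∀ m p q r → tally (replicate m bottom) (p , q , r) ≡ (p + m , q , r)
tally-replicate-bottom zero    p q r = cong (_, q , r) (sym (+-identityʳ p))
tally-replicate-bottom (suc m) p q r = trans (tally-replicate-bottom m (suc p) q r) (cong (_, q , r) (sym (+-suc p m)))

tally-replicate-middle : ∀ m p q r → tally (replicate m middle) (p , q , r) ≡ (p , q + m , r)
tally-replicate-middle zero    p q r = cong (λ t → p , t , r) (sym (+-identityʳ q))
tally-replicate-middle (suc m) p q r = trans (tally-replicate-middle m p (suc q) r) (cong (λ t → p , t , r) (sym (+-suc q m)))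

tally-replicate-top : ∀ m p q r → tally (replicate m top) (p , q , r) ≡ (p , q , r + m)
tally-replicate-top zero    p q r = cong (λ t → p , q , t) (sym (+-identityʳ r))
tally-replicate-top (suc m) p q r = trans (tally-replicate-top m p q (suc r)) (cong (λ t → p , q , t) (sym (+-suc r m)))

tally-pairs : ∀ m p q r → tally (pairs m) (p , q , r) ≡ (p + m , q , r + m)
tally-pairs zero    p q r = cong₂ (λ s t → s , q , t) (sym (+-identityʳ p)) (sym (+-identityʳ r))
tally-pairs (suc m) p q r =
  trans (tally-pairs m (suc p) q (suc r)) (cong₂ (λ s t → s , q , t) (sym (+-suc p m)) (sym (+-suc r m)))

module Word = Inversions rowOf

below-1 : ∀ {m} (w : Vec Part m) → Word.below 1 w ≡ 0
below-1 []           = refl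
below-1 (bottom ∷ w) = below-1 w
below-1 (middle ∷ w) = below-1 w
below-1 (top ∷ w)    = below-1 w

below-pairs : ∀ {r} → 1 < r → r ≤ 3 → ∀ m → Word.below r (pairs m) ≡ m
below-pairs 1<r r≤3 zero    = refl
below-pairs {r} 1<r r≤3 (suc m) = trans
  (cong₂ (λ s t → s + (t + Word.below r (pairs m))) (⟦⟧-true 1<r) (⟦⟧-false (≤⇒≯ r≤3)))
  (cong suc (below-pairs 1<r r≤3 m))

inversions-pairs-++ : ∀ {m′} m (v : Vec Part m′) →
                      Word.inversions (pairs m ++ v) ≡ staircase m (m + Word.below 3 v) + Word.inversions v
inversions-pairs-++ zero    v = refl
inversions-pairs-++ (suc m) v = begin
  Word.below 1 (top ∷ pairs m ++ v) + (Word.below 3 (pairs m ++ v) + Word.inversions (pairs m ++ v))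
    ≡⟨ cong₂ (λ s t → s + (t + Word.inversions (pairs m ++ v))) (below-1 (top ∷ pairs m ++ v)) below3 ⟩
  m + t + Word.inversions (pairs m ++ v)
    ≡⟨ cong (m + t +_) (inversions-pairs-++ m v) ⟩
  m + t + (staircase m (m + t) + Word.inversions v)
    ≡⟨ +-assoc (m + t) _ _ ⟨
  staircase (suc m) (suc m + t) + Word.inversions v ∎
  where
  open ≡-Reasoning
  t = Word.below 3 v
  below3 : Word.below 3 (pairs m ++ v) ≡ m + t
  below3 = trans (Word.below-++ 3 (pairs m) v) (cong (_+ t) (below-pairs (s≤s (s≤s z≤n)) ≤-refl m))

-- The right lobster

split-interval : ∀ s m j → s < j → j ≤ s + m → Σ ℕ λ i → i < m × j ≡ suc (s + i)
split-interval s m (suc j) (s≤s s≤j) j<s+m =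
  j ∸ s , +-cancelˡ-< s _ _ (subst (_< s + m) (sym (m+[n∸m]≡n s≤j)) j<s+m) , cong suc (sym (m+[n∸m]≡n s≤j))

module Lobster (b c₁ c₂ : ℕ) where

  α β : List ℕ
  α = lobsterα b c₁ c₂
  β = lobsterβ b c₁ c₂

  n : ℕ
  n = b + c₁ + c₂

  sizes : Counts
  sizes = c₂ , b , c₁

  size : Part → ℕ
  size x = count x sizes

  firstCol : Part → ℕ
  firstCol middle = 2
  firstCol _      = suc (b + 1)

  cellAt : Part → ℕ → Cell
  cellAt x i = rowOf x , firstCol x + i

  middle-col≤ : ∀ {i} → i < b → firstCol middle + i ≤ b + 1
  middle-col≤ {i} i<b = subst (suc (suc i) ≤_) (+-comm 1 b) (s≤s i<b)

  cellAt-inShape : ∀ x {i} → i < size x → InShape α β (cellAt x i)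
  cellAt-inShape bottom i<c₂ = s≤s (m≤m+n (b + 1) _) , +-monoʳ-< (b + 1) i<c₂
  cellAt-inShape middle i<b  = s≤s (s≤s z≤n) , middle-col≤ i<b
  cellAt-inShape top    i<c₁ = s≤s (m≤m+n (b + 1) _) , +-monoʳ-< (b + 1) i<c₁

  inShape⇒cellAt : ∀ {c} → InShape α β c → Σ Part λ x → Σ ℕ λ i → i < size x × c ≡ cellAt x i
  inShape⇒cellAt {zero , j} (β<j , j≤α) = ⊥-elim (<⇒≱ β<j j≤α)
  inShape⇒cellAt {1 , j} (β<j , j≤α) with split-interval (b + 1) c₂ j β<j j≤α
  ... | i , i<c₂ , refl = bottom , i , i<c₂ , refl
  inShape⇒cellAt {2 , j} (β<j , j≤α) with split-interval 1 b j β<j (subst (j ≤_) (+-comm b 1) j≤α)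
  ... | i , i<b , refl = middle , i , i<b , refl
  inShape⇒cellAt {3 , j} (β<j , j≤α) with split-interval (b + 1) c₁ j β<j j≤α
  ... | i , i<c₁ , refl = top , i , i<c₁ , refl
  inShape⇒cellAt {suc (suc (suc (suc r))) , j} (β<j , j≤α) = ⊥-elim (<⇒≱ β<j j≤α)

  invertedPairs : Filling n → Part → Part → ℕ
  invertedPairs T x y = ∑ (size x) λ i → ∑ (size y) λ j → ⟦ indexOf T (cellAt x i) < indexOf T (cellAt y j) ⟧

  Φ : Filling n → ℕ
  Φ T = invertedPairs T middle bottom + invertedPairs T top middle + invertedPairs T top bottom

  module _ {S : Filling n} {k l : Fin n}
           (adj : Adjacent k l) (descent : row (lookup S l) < row (lookup S k)) (S-SET : IsSET α β n S) where

    private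
      S′ : Filling n
      S′ = swap S k l

    invertedPairs-swap-≤ : ∀ x y → rowOf y < rowOf x → invertedPairs S′ x y ≤ invertedPairs S x y
    invertedPairs-swap-≤ x y y<x = ∑-mono (size x) λ i i< → ∑-mono (size y) λ j j< →
      swap-creates-no-inversion adj descent S-SET (cellAt-inShape x i<) (cellAt-inShape y j<) y<x

    invertedPairs-swap-< : ∀ x y {i j} → i < size x → j < size y →
                           lookup S k ≡ cellAt x i → lookup S l ≡ cellAt y j →
                           invertedPairs S′ x y < invertedPairs S x y
    invertedPairs-swap-< x y i< j< Sk≡ Sl≡ =
      ∑-mono-< (size x) (λ i′ i′< → ∑-mono (size y) λ j′ j′< → no-new i′< j′<) i<
        (∑-mono-< (size y) (λ j′ j′< → no-new i< j′<) j<
          (subst₂ (λ c d → ⟦ indexOf S′ c < indexOf S′ d ⟧ < ⟦ indexOf S c < indexOf S d ⟧) Sk≡ Sl≡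
            (swap-removes-descent-inversion adj descent S-SET)))
      where
      y<x : rowOf y < rowOf x
      y<x = subst₂ (λ c d → row d < row c) Sk≡ Sl≡ descent
      no-new : ∀ {i′ j′} → i′ < size x → j′ < size y →
               ⟦ indexOf S′ (cellAt x i′) < indexOf S′ (cellAt y j′) ⟧ ≤
               ⟦ indexOf S (cellAt x i′) < indexOf S (cellAt y j′) ⟧
      no-new i′< j′< = swap-creates-no-inversion adj descent S-SET (cellAt-inShape x i′<) (cellAt-inShape y j′<) y<x

    Φ-swap-< : Φ S′ < Φ S
    Φ-swap-< with inShape⇒cellAt (IsSET.inShape S-SET k) | inShape⇒cellAt (IsSET.inShape S-SET l)
    ... | x , i , i< , Sk≡ | y , j , j< , Sl≡ =
      combine x y (subst₂ (λ c d → row d < row c) Sk≡ Sl≡ descent) (invertedPairs-swap-< x y i< j< Sk≡ Sl≡)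
      where
      ≤₁ = invertedPairs-swap-≤ middle bottom (s≤s (s≤s z≤n))
      ≤₂ = invertedPairs-swap-≤ top middle (s≤s (s≤s (s≤s z≤n)))
      ≤₃ = invertedPairs-swap-≤ top bottom (s≤s (s≤s z≤n))
      combine : ∀ x y → rowOf y < rowOf x → invertedPairs S′ x y < invertedPairs S x y → Φ S′ < Φ S
      combine middle bottom _ <₁ = +-mono-<-≤ (+-mono-<-≤ <₁ ≤₂) ≤₃
      combine top    middle _ <₂ = +-mono-<-≤ (+-mono-≤-< ≤₁ <₂) ≤₃
      combine top    bottom _ <₃ = +-mono-≤-< (+-mono-≤ ≤₁ ≤₂) <₃
      combine bottom bottom (s≤s ())
      combine bottom middle (s≤s ())
      combine bottom top    (s≤s ())
      combine middle middle (s≤s (s≤s ()))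
      combine middle top    (s≤s (s≤s ()))
      combine top    top    (s≤s (s≤s (s≤s ())))

  Φ-step : ∀ {S T} → Step α β n S T → T ≡ S ⊎ Φ T < Φ S
  Φ-step {S} {T} (S-SET , _ , k , l , adj , πS≡T) with π-fixes-or-swaps-descent S T k l πS≡T
  ... | inj₁ T≡S              = inj₁ T≡S
  ... | inj₂ (descent , refl) = inj₂ (Φ-swap-< adj descent S-SET)

  maxInversions : ℕ
  maxInversions = b * (c₂ ⊔ c₁) + staircase c₁ c₂

  module _ {T : Filling n} (T-SET : IsSET α β n T) where

    private
      ι : Part → ℕ → ℕ
      ι x i = indexOf T (cellAt x i)

    ι-increasing : ∀ x {i j} → i < j → j < size x → ι x i < ι x j
    ι-increasing x i<j j< =
      indexOf-row-increasing T-SET (cellAt-inShape x (<-trans i<j j<)) (cellAt-inShape x j<)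
                             refl (+-monoʳ-< (firstCol x) i<j)

    ι-monotone : ∀ x {i j} → i ≤ j → j < size x → ι x i ≤ ι x j
    ι-monotone x i≤j j< with m≤n⇒m<n∨m≡n i≤j
    ... | inj₁ i<j  = <⇒≤ (ι-increasing x i<j j<)
    ... | inj₂ refl = ≤-refl

    bottom<top : ∀ {i} → i < c₂ → i < c₁ → ι bottom i < ι top i
    bottom<top i<c₂ i<c₁ =
      indexOf-col-increasing T-SET (cellAt-inShape bottom i<c₂) (cellAt-inShape top i<c₁) refl (s≤s (s≤s z≤n))

    middle-inversions≤ : ∀ z → ∑ c₂ (λ j → ⟦ ι middle z < ι bottom j ⟧) + ∑ c₁ (λ i → ⟦ ι top i < ι middle z ⟧)
                               ≤ c₂ ⊔ c₁
    middle-inversions≤ z = ∑+∑-exclusive≤⊔ c₂ c₁ _ _ (λ _ → ⟦⟧≤1 _ _) (λ _ → ⟦⟧≤1 _ _) λ i i<c₂ i<c₁ →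
      ⟦⟧-exclusive λ middle<bottom top<middle → <-asym (<-trans top<middle middle<bottom) (bottom<top i<c₂ i<c₁)

    top-inversions≤ : ∀ {i} → i < c₁ → ∑ c₂ (λ j → ⟦ ι top i < ι bottom j ⟧) ≤ c₂ ∸ suc i
    top-inversions≤ {i} i<c₁ = ∑-indicator≤∸ c₂ (suc i) _ (λ _ → ⟦⟧≤1 _ _) λ j j≤i j<c₂ →
      ⟦⟧-false (<-asym (<-≤-trans (bottom<top j<c₂ (≤-<-trans (s≤s⁻¹ j≤i) i<c₁))
                                  (ι-monotone top (s≤s⁻¹ j≤i) i<c₁)))

    Φ≤maxInversions : Φ T ≤ maxInversions
    Φ≤maxInversions = +-mono-≤ (begin
      invertedPairs T middle bottom + invertedPairs T top middle
        ≡⟨ cong (invertedPairs T middle bottom +_) (∑-comm c₁ b λ i z → ⟦ ι top i < ι middle z ⟧) ⟩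
      invertedPairs T middle bottom + ∑ b (λ z → ∑ c₁ λ i → ⟦ ι top i < ι middle z ⟧)
        ≡⟨ ∑-distrib-+ b _ _ ⟨
      ∑ b (λ z → ∑ c₂ (λ j → ⟦ ι middle z < ι bottom j ⟧) + ∑ c₁ (λ i → ⟦ ι top i < ι middle z ⟧))
        ≤⟨ ∑-mono b (λ z _ → middle-inversions≤ z) ⟩
      ∑ b (λ _ → c₂ ⊔ c₁)
        ≡⟨ ∑-const b (c₂ ⊔ c₁) ⟩
      b * (c₂ ⊔ c₁) ∎)
      (∑-mono c₁ λ i i<c₁ → top-inversions≤ i<c₁)
      where open ≤-Reasoning

  -- The word lists the rows receiving 1, 2, …; each row is filled from left to right,
  -- and the counts record how many of its cells are already used.
  fill : ∀ {m} → Counts → Vec Part m → Filling m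
  fill a []      = []
  fill a (x ∷ w) = cellAt x (count x a) ∷ fill (next x a) w

  fill-cell : ∀ {m} a (w : Vec Part m) k → Σ Part λ x → Σ ℕ λ i →
              count x a ≤ i × i < count x (tally w a) × lookup (fill a w) k ≡ cellAt x i
  fill-cell a (x ∷ w) zero =
    x , count x a , ≤-refl ,
    <-≤-trans (≤-reflexive (sym (count-next-self x a))) (count-tally-≤ x w (next x a)) , refl
  fill-cell a (x ∷ w) (suc k) with fill-cell (next x a) w k
  ... | y , i , lo , hi , eq = y , i , ≤-trans (count-next-≤ x y a) lo , hi , eq

  fill-tail-right-of-head : ∀ {m} x a (w : Vec Part m) k → row (lookup (fill (next x a) w) k) ≡ rowOf x →
                    firstCol x + count x a < col (lookup (fill (next x a) w) k)
  fill-tail-right-of-head x a w k with lookup (fill (next x a) w) k | fill-cell (next x a) w k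
  ... | _ | y , i , lo , _ , refl = λ same-row → helper (rowOf-injective same-row) lo
    where
    helper : y ≡ x → count y (next x a) ≤ i → firstCol x + count x a < firstCol y + i
    helper refl lo = +-monoʳ-< (firstCol x) (subst (_≤ i) (count-next-self x a) lo)

  fill-injective : ∀ {m} a (w : Vec Part m) k l → lookup (fill a w) k ≡ lookup (fill a w) l → k ≡ l
  fill-injective a (x ∷ w) zero    zero    _  = refl
  fill-injective a (x ∷ w) zero    (suc l) eq =
    ⊥-elim (<-irrefl (cong col eq) (fill-tail-right-of-head x a w l (cong row (sym eq))))
  fill-injective a (x ∷ w) (suc k) zero    eq =
    ⊥-elim (<-irrefl (cong col (sym eq)) (fill-tail-right-of-head x a w k (cong row eq)))
  fill-injective a (x ∷ w) (suc k) (suc l) eq = cong suc (fill-injective (next x a) w k l eq)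

  fill-rowInc : ∀ {m} a (w : Vec Part m) k l → row (lookup (fill a w) k) ≡ row (lookup (fill a w) l) →
                col (lookup (fill a w) k) < col (lookup (fill a w) l) → toℕ k < toℕ l
  fill-rowInc a (x ∷ w) zero    zero    _        col< = ⊥-elim (<-irrefl refl col<)
  fill-rowInc a (x ∷ w) zero    (suc l) _        _    = z<s
  fill-rowInc a (x ∷ w) (suc k) zero    same-row col< = ⊥-elim (<-asym col< (fill-tail-right-of-head x a w k same-row))
  fill-rowInc a (x ∷ w) (suc k) (suc l) same-row col< = s≤s (fill-rowInc (next x a) w k l same-row col<)

  fill-inShape : ∀ {m} a (w : Vec Part m) → tally w a ≡ sizes → ∀ k → InShape α β (lookup (fill a w) k)
  fill-inShape a w tally≡ k with lookup (fill a w) k | fill-cell a w k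
  ... | _ | x , i , _ , hi , refl = cellAt-inShape x (subst (λ t → i < count x t) tally≡ hi)

  fill-onto : ∀ {m} x i a (w : Vec Part m) → count x a ≤ i → i < count x (tally w a) →
              ∃ λ k → lookup (fill a w) k ≡ cellAt x i
  fill-onto x i a []      lo hi = ⊥-elim (<⇒≱ hi lo)
  fill-onto x i a (y ∷ w) lo hi with y ≟ₚ x
  ... | no y≢x =
    let k , eq = fill-onto x i (next y a) w (subst (_≤ i) (sym (count-next-other y≢x a)) lo) hi in suc k , eq
  ... | yes refl with count x a ≟ i
  ...   | yes refl = zero , refl
  ...   | no ≢i    =
    let k , eq = fill-onto x i (next x a) w (subst (_≤ i) (sym (count-next-self x a)) (≤∧≢⇒< lo ≢i)) hi in suc k , eq

  -- Column strictness: a top cell is filled only after the bottom cell below it, if any.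
  Admissible : Part → Counts → Set
  Admissible top a = count top a < c₂ → count top a < count bottom a
  Admissible _   _ = ⊤

  Balanced : ∀ {m} → Counts → Vec Part m → Set
  Balanced a []      = ⊤
  Balanced a (x ∷ w) = Admissible x a × Balanced (next x a) w

  no-cell-below : ∀ x y a {i} → Admissible x a → count x a < size x → count y (next x a) ≤ i → i < size y →
                  firstCol y + i ≡ firstCol x + count x a → ¬ rowOf y < rowOf x
  no-cell-below bottom bottom _ _ _ _ _ _ (s≤s ())
  no-cell-below bottom middle _ _ _ _ _ _ (s≤s ())
  no-cell-below bottom top    _ _ _ _ _ _ (s≤s ())
  no-cell-below middle bottom (p , q , r) {i} _ q<b _ _ same-col _ =
    <-irrefl (sym same-col) (≤-<-trans (middle-col≤ q<b) (s≤s (m≤m+n (b + 1) i)))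
  no-cell-below middle middle _ _ _ _ _ _ (s≤s (s≤s ()))
  no-cell-below middle top    _ _ _ _ _ _ (s≤s (s≤s ()))
  no-cell-below top    bottom (p , q , r) admissible _ p≤i i<c₂ same-col _ =
    <⇒≱ (admissible (subst (_< c₂) i≡r i<c₂)) (subst (p ≤_) i≡r p≤i)
    where i≡r = +-cancelˡ-≡ (suc (b + 1)) _ _ same-col
  no-cell-below top    middle (p , q , r) {i} _ _ _ i<b same-col _ =
    <-irrefl same-col (≤-<-trans (middle-col≤ i<b) (s≤s (m≤m+n (b + 1) r)))
  no-cell-below top    top    _ _ _ _ _ _ (s≤s (s≤s (s≤s ())))

  fill-colInc : ∀ {m} a (w : Vec Part m) → tally w a ≡ sizes → Balanced a w → ∀ k l →
                col (lookup (fill a w) k) ≡ col (lookup (fill a w) l) →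
                row (lookup (fill a w) k) < row (lookup (fill a w) l) → toℕ k < toℕ l
  fill-colInc a (x ∷ w) _       _                        zero    zero    _ row< = ⊥-elim (<-irrefl refl row<)
  fill-colInc a (x ∷ w) _       _                        zero    (suc l) _ _    = z<s
  fill-colInc a (x ∷ w) tally≡ (admissible , _) (suc k) zero    = below-head
    where
    x-fits : count x a < size x
    x-fits = <-≤-trans (≤-reflexive (sym (count-next-self x a)))
               (subst (λ t → count x (next x a) ≤ count x t) tally≡ (count-tally-≤ x w (next x a)))
    below-head : col (lookup (fill (next x a) w) k) ≡ firstCol x + count x a →
                 row (lookup (fill (next x a) w) k) < rowOf x → toℕ (suc k) < 0
    below-head with lookup (fill (next x a) w) k | fill-cell (next x a) w k
    ... | _ | y , i , lo , hi , refl = λ same-col lower →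
      ⊥-elim (no-cell-below x y a admissible x-fits lo (subst (λ t → i < count y t) tally≡ hi) same-col lower)
  fill-colInc a (x ∷ w) tally≡ (_ , balanced) (suc k) (suc l) same-col row< =
    s≤s (fill-colInc (next x a) w tally≡ balanced k l same-col row<)

  fill-SET : (w : Vec Part n) → tally w (0 , 0 , 0) ≡ sizes → Balanced (0 , 0 , 0) w → IsSET α β n (fill (0 , 0 , 0) w)
  fill-SET w tally≡ balanced = record
    { inShape   = fill-inShape (0 , 0 , 0) w tally≡
    ; onto      = onto
    ; injective = fill-injective (0 , 0 , 0) w
    ; rowInc    = fill-rowInc (0 , 0 , 0) w
    ; colInc    = fill-colInc (0 , 0 , 0) w tally≡ balanced
    }
    where
    onto : ∀ c → InShape α β c → ∃ λ k → lookup (fill (0 , 0 , 0) w) k ≡ c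
    onto c c∈ with inShape⇒cellAt {c} c∈
    ... | x , i , i< , refl =
      fill-onto x i (0 , 0 , 0) w (nothing-filled x) (subst (λ t → i < count x t) (sym tally≡) i<)
      where
      nothing-filled : ∀ y → count y (0 , 0 , 0) ≤ i
      nothing-filled bottom = z≤n
      nothing-filled middle = z≤n
      nothing-filled top    = z≤n

  inversions-fill : ∀ {m} a (w : Vec Part m) → Inversions.inversions row (fill a w) ≡ Word.inversions w
  inversions-fill a []      = refl
  inversions-fill a (x ∷ w) = cong₂ _+_ (below-fill (next x a) w) (inversions-fill (next x a) w)
    where
    below-fill : ∀ {m} a (w : Vec Part m) → Inversions.below row (rowOf x) (fill a w) ≡ Word.below (rowOf x) w
    below-fill a []      = refl
    below-fill a (y ∷ w) = cong (⟦ rowOf y < rowOf x ⟧ +_) (below-fill (next y a) w)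

  chain-from-word : ∀ {m} (w : Vec Part m) → m ≡ n → tally w (0 , 0 , 0) ≡ sizes → Balanced (0 , 0 , 0) w →
                    Chain α β n (Word.inversions w)
  chain-from-word w refl tally≡ balanced =
    subst (Chain α β n) (inversions-fill (0 , 0 , 0) w) (chain-from-SET _ (fill-SET w tally≡ balanced))

  Balanced-++ : ∀ {m m′} a (u : Vec Part m) (v : Vec Part m′) →
                Balanced a u → Balanced (tally u a) v → Balanced a (u ++ v)
  Balanced-++ a []      v _                    bv = bv
  Balanced-++ a (x ∷ u) v (admissible , bu) bv = admissible , Balanced-++ (next x a) u v bu bv

  Balanced-replicate : ∀ x → (∀ a → Admissible x a) → ∀ m a → Balanced a (replicate m x)
  Balanced-replicate x admissible zero    a = tt
  Balanced-replicate x admissible (suc m) a = admissible a , Balanced-replicate x admissible m (next x a)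

  Balanced-replicate-top : ∀ m p q r → c₂ ≤ r → Balanced (p , q , r) (replicate m top)
  Balanced-replicate-top zero    p q r c₂≤r = tt
  Balanced-replicate-top (suc m) p q r c₂≤r =
    (λ r<c₂ → ⊥-elim (<⇒≱ r<c₂ c₂≤r)) , Balanced-replicate-top m p q (suc r) (m≤n⇒m≤1+n c₂≤r)

  Balanced-pairs : ∀ m p q → Balanced (p , q , p) (pairs m)
  Balanced-pairs zero    p q = tt
  Balanced-pairs (suc m) p q = tt , (λ _ → n<1+n p) , Balanced-pairs m (suc p) q

-- Extremal tableaux and the rank

LobsterChain : ℕ → ℕ → ℕ → Set
LobsterChain b c₁ c₂ =
  Chain (lobsterα b c₁ c₂) (lobsterβ b c₁ c₂) (b + c₁ + c₂) (Lobster.maxInversions b c₁ c₂)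

module BottomHeavy (b c d : ℕ) where
  open Lobster b c (c + d)

  word : Vec Part (b + (c * 2 + d))
  word = replicate b middle ++ (pairs c ++ replicate d bottom)

  word-tally : tally word (0 , 0 , 0) ≡ sizes
  word-tally = begin
    tally word (0 , 0 , 0)
      ≡⟨ tally-++ (replicate b middle) (pairs c ++ replicate d bottom) _ ⟩
    tally (pairs c ++ replicate d bottom) (tally (replicate b middle) (0 , 0 , 0))
      ≡⟨ cong (tally (pairs c ++ replicate d bottom)) (tally-replicate-middle b 0 0 0) ⟩
    tally (pairs c ++ replicate d bottom) (0 , b , 0)
      ≡⟨ tally-++ (pairs c) (replicate d bottom) _ ⟩
    tally (replicate d bottom) (tally (pairs c) (0 , b , 0))
      ≡⟨ cong (tally (replicate d bottom)) (tally-pairs c 0 b 0) ⟩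
    tally (replicate d bottom) (c , b , c)
      ≡⟨ tally-replicate-bottom d c b c ⟩
    (c + d , b , c) ∎
    where open ≡-Reasoning

  word-balanced : Balanced (0 , 0 , 0) word
  word-balanced = Balanced-++ _ (replicate b middle) _ (Balanced-replicate middle (λ _ → tt) b _)
    (subst (λ a → Balanced a (pairs c ++ replicate d bottom)) (sym (tally-replicate-middle b 0 0 0))
      (Balanced-++ _ (pairs c) (replicate d bottom) (Balanced-pairs c 0 b) (Balanced-replicate bottom (λ _ → tt) d _)))

  word-inversions : Word.inversions word ≡ maxInversions
  word-inversions = begin
    Word.inversions word
      ≡⟨ Word.inversions-replicate-++ b middle (pairs c ++ replicate d bottom) ⟩
    b * Word.below 2 (pairs c ++ replicate d bottom) + Word.inversions (pairs c ++ replicate d bottom)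
      ≡⟨ cong₂ _+_ (cong (b *_) below-2) (inversions-pairs-++ c (replicate d bottom)) ⟩
    b * (c + d) + (staircase c (c + Word.below 3 (replicate d bottom)) + Word.inversions (replicate d bottom))
      ≡⟨ cong₂ (λ s t → b * (c + d) + (staircase c (c + s) + t))
               (below-bottoms (s≤s (s≤s z≤n))) (Word.inversions-replicate d bottom) ⟩
    b * (c + d) + (staircase c (c + d) + 0)
      ≡⟨ cong₂ (λ s t → b * s + t) (sym (m≥n⇒m⊔n≡m (m≤m+n c d))) (+-identityʳ _) ⟩
    maxInversions ∎
    where
    open ≡-Reasoning
    below-bottoms : ∀ {r} → 1 < r → Word.below r (replicate d bottom) ≡ d
    below-bottoms {r} 1<r = trans (Word.below-replicate r d bottom) (trans (cong (d *_) (⟦⟧-true 1<r)) (*-identityʳ d))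
    below-2 : Word.below 2 (pairs c ++ replicate d bottom) ≡ c + d
    below-2 = trans (Word.below-++ 2 (pairs c) (replicate d bottom))
                    (cong₂ _+_ (below-pairs ≤-refl (s≤s (s≤s z≤n)) c) (below-bottoms ≤-refl))

  chain : LobsterChain b c (c + d)
  chain = subst (Chain α β n) word-inversions (chain-from-word word (length≡ b c d) word-tally word-balanced)
    where
    length≡ : ∀ b c d → b + (c * 2 + d) ≡ b + c + (c + d)
    length≡ = solve-∀

module TopHeavy (b c e : ℕ) where
  open Lobster b (c + e) c

  word : Vec Part (c * 2 + (e + b))
  word = pairs c ++ (replicate e top ++ replicate b middle)

  word-tally : tally word (0 , 0 , 0) ≡ sizes
  word-tally = begin
    tally word (0 , 0 , 0)
      ≡⟨ tally-++ (pairs c) (replicate e top ++ replicate b middle) _ ⟩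
    tally (replicate e top ++ replicate b middle) (tally (pairs c) (0 , 0 , 0))
      ≡⟨ cong (tally (replicate e top ++ replicate b middle)) (tally-pairs c 0 0 0) ⟩
    tally (replicate e top ++ replicate b middle) (c , 0 , c)
      ≡⟨ tally-++ (replicate e top) (replicate b middle) _ ⟩
    tally (replicate b middle) (tally (replicate e top) (c , 0 , c))
      ≡⟨ cong (tally (replicate b middle)) (tally-replicate-top e c 0 c) ⟩
    tally (replicate b middle) (c , 0 , c + e)
      ≡⟨ tally-replicate-middle b c 0 (c + e) ⟩
    (c , b , c + e) ∎
    where open ≡-Reasoning

  word-balanced : Balanced (0 , 0 , 0) word
  word-balanced = Balanced-++ _ (pairs c) _ (Balanced-pairs c 0 0)
    (subst (λ a → Balanced a (replicate e top ++ replicate b middle)) (sym (tally-pairs c 0 0 0))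
      (Balanced-++ _ (replicate e top) (replicate b middle)
        (Balanced-replicate-top e c 0 c ≤-refl) (Balanced-replicate middle (λ _ → tt) b _)))

  word-inversions : Word.inversions word ≡ maxInversions
  word-inversions = begin
    Word.inversions word
      ≡⟨ inversions-pairs-++ c (replicate e top ++ replicate b middle) ⟩
    staircase c (c + Word.below 3 (replicate e top ++ replicate b middle))
      + Word.inversions (replicate e top ++ replicate b middle)
      ≡⟨ cong₂ (λ s t → staircase c (c + s) + t) below-3 (Word.inversions-replicate-++ e top (replicate b middle)) ⟩
    staircase c (c + b) + (e * Word.below 3 (replicate b middle) + Word.inversions (replicate b middle))
      ≡⟨ cong₂ (λ s t → staircase c (c + b) + (e * s + t)) middles-below-3 (Word.inversions-replicate b middle) ⟩
    staircase c (c + b) + (e * b + 0)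
      ≡⟨ cong (_+ (e * b + 0)) (staircase-shift c b) ⟩
    c * b + staircase c c + (e * b + 0)
      ≡⟨ rearrange b c e (staircase c c) ⟩
    b * (c + e) + staircase c c
      ≡⟨ cong₂ (λ s t → b * s + t) (sym (m≤n⇒m⊔n≡n (m≤m+n c e))) (sym (staircase-overhang c e)) ⟩
    maxInversions ∎
    where
    open ≡-Reasoning
    middles-below-3 : Word.below 3 (replicate b middle) ≡ b
    middles-below-3 = trans (Word.below-replicate 3 b middle) (*-identityʳ b)
    below-3 : Word.below 3 (replicate e top ++ replicate b middle) ≡ b
    below-3 = trans (Word.below-++ 3 (replicate e top) (replicate b middle))
                    (cong₂ _+_ (trans (Word.below-replicate 3 e top) (*-zeroʳ e)) middles-below-3)
    rearrange : ∀ b c e s → c * b + s + (e * b + 0) ≡ b * (c + e) + s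
    rearrange = solve-∀

  chain : LobsterChain b (c + e) c
  chain = subst (Chain α β n) word-inversions (chain-from-word word (length≡ b c e) word-tally word-balanced)
    where
    length≡ : ∀ b c e → c * 2 + (e + b) ≡ b + (c + e) + c
    length≡ = solve-∀

longest-chain : ∀ b c₁ c₂ → LobsterChain b c₁ c₂
longest-chain b c₁ c₂ with ≤-total c₁ c₂
... | inj₁ c₁≤c₂ = subst (LobsterChain b c₁) (m+[n∸m]≡n c₁≤c₂) (BottomHeavy.chain b c₁ (c₂ ∸ c₁))
... | inj₂ c₂≤c₁ = subst (λ c → LobsterChain b c c₂)  (m+[n∸m]≡n c₂≤c₁) (TopHeavy.chain b c₂ (c₁ ∸ c₂))

maxInversions-bottomHeavy : ∀ b c d → (c + d) * (b + c) ∸ ((c + 1) C 2) ≡ Lobster.maxInversions b c (c + d)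
maxInversions-bottomHeavy b c d = begin
  (c + d) * (b + c) ∸ ((c + 1) C 2)             ≡⟨ cong ((c + d) * (b + c) ∸_) c+1C2 ⟩
  (c + d) * (b + c) ∸ (c + s)                   ≡⟨ cong (_∸ (c + s)) expand ⟩
  b * (c + d) + (c * d + s) + (c + s) ∸ (c + s) ≡⟨ m+n∸n≡m _ (c + s) ⟩
  b * (c + d) + (c * d + s)                     ≡⟨ cong₂ (λ u v → b * u + v) (sym (m≥n⇒m⊔n≡m (m≤m+n c d)))
                                                                           (sym (staircase-shift c d)) ⟩
  Lobster.maxInversions b c (c + d)             ∎
  where
  open ≡-Reasoning
  s = staircase c c
  c+1C2 : (c + 1) C 2 ≡ c + s
  c+1C2 = begin
    (c + 1) C 2 ≡⟨ cong (_C 2) (+-comm c 1) ⟩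
    suc c C 2   ≡⟨ staircase-diagonal (suc c) ⟨
    c + s       ∎
  expand : (c + d) * (b + c) ≡ b * (c + d) + (c * d + s) + (c + s)
  expand = begin
    (c + d) * (b + c)                         ≡⟨ rearrange₁ b c d ⟩
    b * (c + d) + c * d + c * c               ≡⟨ cong (b * (c + d) + c * d +_) (staircase-double c) ⟨
    b * (c + d) + c * d + (c + (s + s))       ≡⟨ rearrange₂ b c d s ⟩
    b * (c + d) + (c * d + s) + (c + s)       ∎
    where
    rearrange₁ : ∀ b c d → (c + d) * (b + c) ≡ b * (c + d) + c * d + c * c
    rearrange₁ = solve-∀
    rearrange₂ : ∀ b c d s → b * (c + d) + c * d + (c + (s + s)) ≡ b * (c + d) + (c * d + s) + (c + s)
    rearrange₂ = solve-∀

maxInversions-topHeavy : ∀ b c e → b * (c + e) + c C 2 ≡ Lobster.maxInversions b (c + e) c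
maxInversions-topHeavy b c e =
  cong₂ (λ u v → b * u + v) (sym (m≤n⇒m⊔n≡n (m≤m+n c e)))
        (trans (sym (staircase-diagonal c)) (sym (staircase-overhang c e)))

lobsterRank≡maxInversions : ∀ b c₁ c₂ → lobsterRank b c₁ c₂ ≡ Lobster.maxInversions b c₁ c₂
lobsterRank≡maxInversions b c₁ c₂ with c₁ ≤ᵇ c₂ in c₁≤ᵇc₂
... | true  = subst (λ c → c * (b + c₁) ∸ ((c₁ + 1) C 2) ≡ Lobster.maxInversions b c₁ c) (m+[n∸m]≡n c₁≤c₂)
                    (maxInversions-bottomHeavy b c₁ (c₂ ∸ c₁))
  where c₁≤c₂ = ≤ᵇ⇒≤ c₁ c₂ (subst T (sym c₁≤ᵇc₂) tt)
... | false = subst (λ c → b * c + c₂ C 2 ≡ Lobster.maxInversions b c c₂) (m+[n∸m]≡n c₂≤c₁)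
                    (maxInversions-topHeavy b c₂ (c₁ ∸ c₂))
  where c₂≤c₁ = <⇒≤ (≰⇒> λ c₁≤c₂ → subst T c₁≤ᵇc₂ (≤⇒≤ᵇ c₁≤c₂))

corollary26 : (b c₁ c₂ : ℕ) → 1 ≤ b → 1 ≤ c₁ → 1 ≤ c₂ →
    IsRank (lobsterα b c₁ c₂) (lobsterβ b c₁ c₂) (b + c₁ + c₂) (lobsterRank b c₁ c₂)
-- The formula holds without the positivity hypotheses.
corollary26 b c₁ c₂ _ _ _ =
  subst (IsRank (lobsterα b c₁ c₂) (lobsterβ b c₁ c₂) (b + c₁ + c₂)) (sym (lobsterRank≡maxInversions b c₁ c₂))
    (longest-chain b c₁ c₂ , chain-length≤ Φ Φ-step (λ _ → Φ≤maxInversions))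
  where open Lobster b c₁ c₂
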